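{- Let $n\ge 1$ and let $\alpha_1,\alpha_2,\ldots,\alpha_m$ be binary strings such that each $\alpha_i$ has the same number of $0$s as $1$s and satisfies $\operatorname{disc}(\alpha_i)\le n$. Then $\operatorname{disc}(\alpha_1\alpha_2\cdots\alpha_m)\le 2n$.
   Context: For a binary string $w$ and a symbol $a$, $|w|_a$ is the number of occurrences of $a$ in $w$. $\operatorname{csub}(w)$ denotes the set of all substrings of $w$ when $w$ is interpreted as a circular string (including the empty string). The discrepancy of $w$ is $\operatorname{disc}(w)=\max_{u\in \operatorname{csub}(w)}\big|\,|u|_1-|u|_0\,\big|$. -}

module Defs where

open import Data.Bool using (Bool; true; false; _≟_)
open import Relation.Nullary using (yes; no)
open import Data.Nat using (ℕ; zero; suc; _⊔_)
open import Data.Integer as ℤ using (ℤ; +_; ∣_∣)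
open import Data.List using (List; []; _∷_; _++_; take; drop; length; upTo; concatMap; map; foldr; concat)

-- Binary strings: true = symbol 1, false = symbol 0.
BinStr : Set
BinStr = List Bool

count : Bool → BinStr → ℕ
count a [] = 0
count a (b ∷ w) with a ≟ b
... | yes _ = suc (count a w)
... | no _  = count a w

balance : BinStr → ℤ
balance w = (+ count true w) ℤ.- (+ count false w)

rotate : ℕ → BinStr → BinStr
rotate i w = drop i w ++ take i w

-- csub(w): all substrings of w read circularly (including the empty string),
-- i.e. every prefix of length k ≤ |w| of every rotation of w.
csub : BinStr → List BinStr
csub w = [] ∷ concat (map (λ i → map (λ k → take k (rotate i w)) (upTo (suc (length w)))) (upTo (length w)))

disc : BinStr → ℕ
disc w = foldr (λ u m → ∣ balance u ∣ ⊔ m) 0 (csub w)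

module Submission where

-- Write P w t for the balance |u|₁ - |u|₀ of the length-t prefix
-- u of w.  Balance is additive under concatenation, so
--   (1) for a concatenation of balanced blocks, every prefix is a union of
--       whole blocks (balance 0) followed by a prefix of one block, whose
--       balance is bounded by that block's discrepancy; hence every prefix of
--       α₁⋯αₘ has |P| ≤ n;
--   (2) in a balanced word w every circular substring is either a factor
--       w[a..b) or a suffix followed by a prefix; in both cases its balance
--       is a difference P w a - P w b of two prefix balances (for the
--       wrap-around case because P w |w| = 0).
-- Combining (1) and (2) bounds every circular substring of α₁⋯αₘ by n + n.
-- The file first develops the list and balance algebra, then the two
-- characterisations of disc as a maximum (upper bound, least upper bound),
-- then (1) and (2), and finally the theorem.

open import Defs
open import Data.Nat using (ℕ; _≤_; _*_)
open import Data.List using (List; concat)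
open import Data.List.Relation.Unary.All using (All)
open import Data.Bool using (true; false)
open import Relation.Binary.PropositionalEquality using (_≡_)

open import Data.Bool using (Bool; _≟_)
open import Data.Nat using (zero; suc; _+_; _∸_; _⊓_; _⊔_; _<_; _≤?_; z≤n; s≤s)
import Data.Nat.Properties as ℕP
open import Data.Integer as ℤ using (ℤ; +_; ∣_∣)
import Data.Integer.Properties as ℤP
open import Data.List using ([]; _∷_; _++_; take; drop; length; map; upTo; foldr)
import Data.List.Properties as LP
open import Data.List.Relation.Unary.All using ([]; _∷_)
open import Data.List.Relation.Unary.All.Properties using (concat⁺)
open import Data.List.Relation.Unary.Any using (here; there)
open import Data.List.Membership.Propositional using (_∈_)
open import Data.List.Membership.Propositional.Properties using (∈-map⁺; ∈-upTo⁺; ∈-concat⁺′)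
open import Data.Product using (∃₂; _,_)
open import Relation.Binary.PropositionalEquality using (refl; sym; trans; cong; cong₂; subst; module ≡-Reasoning)
open import Relation.Nullary using (yes; no)
open import Data.Integer.Solver using (module +-*-Solver)

prefixBalance : BinStr → ℕ → ℤ
prefixBalance w t = balance (take t w)

take-++ : ∀ {A : Set} k (x y : List A) → take k (x ++ y) ≡ take k x ++ take (k ∸ length x) y
take-++ zero    []      y = refl
take-++ zero    (b ∷ x) y = refl
take-++ (suc k) []      y = refl
take-++ (suc k) (b ∷ x) y = cong (b ∷_) (take-++ k x y)

take-+ : ∀ {A : Set} i k (w : List A) → take (i + k) w ≡ take i w ++ take k (drop i w)
take-+ zero    k w       = refl
take-+ (suc i) k []      = sym (LP.take-[] k)
take-+ (suc i) k (b ∷ w) = cong (b ∷_) (take-+ i k w)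

count-++ : ∀ a x y → count a (x ++ y) ≡ count a x + count a y
count-++ a []      y = refl
count-++ a (b ∷ x) y with a ≟ b
... | yes _ = cong suc (count-++ a x y)
... | no _  = count-++ a x y

balance-++ : ∀ x y → balance (x ++ y) ≡ balance x ℤ.+ balance y
balance-++ x y
  rewrite count-++ true x y | count-++ false x y
        | ℤP.pos-+ (count true x) (count true y) | ℤP.pos-+ (count false x) (count false y)
  = solve 4 (λ a b c d → (a :+ b) :- (c :+ d) := (a :- c) :+ (b :- d)) refl
      (+ count true x) (+ count true y) (+ count false x) (+ count false y)
  where open +-*-Solver

balanced⇒balance≡0 : ∀ w → count false w ≡ count true w → balance w ≡ + 0
balanced⇒balance≡0 w e rewrite e = ℤP.+-inverseʳ (+ count true w)

balance-concat : ∀ αs → All (λ α → count false α ≡ count true α) αs → balance (concat αs) ≡ + 0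
balance-concat []       []       = refl
balance-concat (α ∷ αs) (e ∷ es)
  rewrite balance-++ α (concat αs) | balanced⇒balance≡0 α e | balance-concat αs es = refl

prefixBalance-++ : ∀ x y t →
  prefixBalance (x ++ y) t ≡ prefixBalance x t ℤ.+ prefixBalance y (t ∸ length x)
prefixBalance-++ x y t =
  trans (cong balance (take-++ t x y)) (balance-++ (take t x) (take (t ∸ length x) y))

rotation-prefix∈csub : ∀ w i k → i < length w → k ≤ length w →
  take k (rotate i w) ∈ csub w
rotation-prefix∈csub w i k i<L k≤L =
  there (∈-concat⁺′ (∈-map⁺ (λ k → take k (rotate i w)) (∈-upTo⁺ (s≤s k≤L)))
                    (∈-map⁺ prefixesOf (∈-upTo⁺ i<L)))
  where
  prefixesOf : ℕ → List BinStr
  prefixesOf i = map (λ k → take k (rotate i w)) (upTo (suc (length w)))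

≤-disc : ∀ {u} w → u ∈ csub w → ∣ balance u ∣ ≤ disc w
≤-disc w = ≤-fold (csub w)
  where
  ≤-fold : ∀ {u} us → u ∈ us → ∣ balance u ∣ ≤ foldr (λ v m → ∣ balance v ∣ ⊔ m) 0 us
  ≤-fold (v ∷ us) (here refl) = ℕP.m≤m⊔n _ _
  ≤-fold (v ∷ us) (there m)   = ℕP.≤-trans (≤-fold us m) (ℕP.m≤n⊔m _ _)

disc-≤ : ∀ c w → (∀ i k → ∣ balance (take k (rotate i w)) ∣ ≤ c) → disc w ≤ c
disc-≤ c w h =
  fold-≤ (csub w) (z≤n ∷ concat⁺ (all-map (upTo (length w)) λ i → all-map (upTo (suc (length w))) (h i)))
  where
  all-map : ∀ {A : Set} {Q : A → Set} {f : ℕ → A} xs → (∀ x → Q (f x)) → All Q (map f xs)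
  all-map []       q = []
  all-map (x ∷ xs) q = q x ∷ all-map xs q
  fold-≤ : ∀ us → All (λ u → ∣ balance u ∣ ≤ c) us → foldr (λ v m → ∣ balance v ∣ ⊔ m) 0 us ≤ c
  fold-≤ []       []       = z≤n
  fold-≤ (u ∷ us) (p ∷ ps) = ℕP.⊔-lub p (fold-≤ us ps)

prefixBalance-≤-disc : ∀ w t → ∣ prefixBalance w t ∣ ≤ disc w
prefixBalance-≤-disc []      t = subst (λ u → ∣ balance u ∣ ≤ 0) (sym (LP.take-[] t)) z≤n
prefixBalance-≤-disc (b ∷ w) t = subst (λ u → ∣ balance u ∣ ≤ disc (b ∷ w)) prefix≡
  (≤-disc (b ∷ w) (rotation-prefix∈csub (b ∷ w) 0 (t ⊓ L) (s≤s z≤n) (ℕP.m⊓n≤n t L)))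
  where
  L = length (b ∷ w)
  prefix≡ : take (t ⊓ L) (rotate 0 (b ∷ w)) ≡ take t (b ∷ w)
  prefix≡ = begin
    take (t ⊓ L) ((b ∷ w) ++ [])  ≡⟨ cong (take (t ⊓ L)) (LP.++-identityʳ (b ∷ w)) ⟩
    take (t ⊓ L) (b ∷ w)          ≡⟨ sym (LP.take-take t L (b ∷ w)) ⟩
    take t (take L (b ∷ w))       ≡⟨ cong (take t) (LP.take-all L (b ∷ w) ℕP.≤-refl) ⟩
    take t (b ∷ w)                ∎
    where open ≡-Reasoning

-- (1) A prefix of α₁⋯αₘ is whole blocks (balance 0) followed by a prefix of
-- one block, so its balance is bounded by the block discrepancies.
concat-prefixBalance-≤ : ∀ {n} αs → All (λ α → count false α ≡ count true α) αs →
  All (λ α → disc α ≤ n) αs → ∀ t → ∣ prefixBalance (concat αs) t ∣ ≤ n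
concat-prefixBalance-≤ []       []       []       t rewrite LP.take-[] {A = Bool} t = z≤n
concat-prefixBalance-≤ (α ∷ αs) (e ∷ es) (d ∷ ds) t
  rewrite prefixBalance-++ α (concat αs) t with t ≤? length α
... | yes t≤|α| rewrite ℕP.m≤n⇒m∸n≡0 t≤|α| | ℤP.+-identityʳ (prefixBalance α t)
  = ℕP.≤-trans (prefixBalance-≤-disc α t) d
... | no t>|α|
  rewrite LP.take-all t α (ℕP.<⇒≤ (ℕP.≰⇒> t>|α|)) | balanced⇒balance≡0 α e
        | ℤP.+-identityˡ (prefixBalance (concat αs) (t ∸ length α))
  = concat-prefixBalance-≤ αs es ds (t ∸ length α)

rotation-prefixBalance : ∀ w i k →
  balance (take k (rotate i w)) ≡
  (prefixBalance w (i + k) ℤ.- prefixBalance w i) ℤ.+ prefixBalance w ((k ∸ length (drop i w)) ⊓ i)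
rotation-prefixBalance w i k = begin
  balance (take k (d ++ take i w))                       ≡⟨ prefixBalance-++ d (take i w) k ⟩
  balance (take k d) ℤ.+ balance (take j (take i w))      ≡⟨ cong₂ ℤ._+_ factor (cong balance (LP.take-take j i w)) ⟩
  (P (i + k) ℤ.- P i) ℤ.+ P (j ⊓ i)                       ∎
  where
  open ≡-Reasoning
  d = drop i w
  j = k ∸ length d
  P = prefixBalance w
  factor : balance (take k d) ≡ P (i + k) ℤ.- P i
  factor = begin
    balance (take k d)                         ≡⟨ solve 2 (λ a b → b := (a :+ b) :- a) refl (P i) (balance (take k d)) ⟩
    (P i ℤ.+ balance (take k d)) ℤ.- P i       ≡⟨ cong (ℤ._- P i) (sym (trans (cong balance (take-+ i k w)) (balance-++ (take i w) (take k d)))) ⟩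
    P (i + k) ℤ.- P i                          ∎
    where open +-*-Solver

circular-balance-as-difference : ∀ w → balance w ≡ + 0 → ∀ i k →
  ∃₂ λ a b → balance (take k (rotate i w)) ≡ prefixBalance w a ℤ.- prefixBalance w b
circular-balance-as-difference w w≡0 i k with k ≤? length (drop i w)
... | yes k≤|d| = i + k , i , (begin
  balance (take k (rotate i w))                                ≡⟨ rotation-prefixBalance w i k ⟩
  (P (i + k) ℤ.- P i) ℤ.+ P ((k ∸ length (drop i w)) ⊓ i)      ≡⟨ cong (λ j → (P (i + k) ℤ.- P i) ℤ.+ P (j ⊓ i)) (ℕP.m≤n⇒m∸n≡0 k≤|d|) ⟩
  (P (i + k) ℤ.- P i) ℤ.+ + 0                                  ≡⟨ ℤP.+-identityʳ _ ⟩
  P (i + k) ℤ.- P i                                            ∎)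
  where
  open ≡-Reasoning
  P = prefixBalance w
... | no k>|d| = j ⊓ i , i , (begin
  balance (take k (rotate i w))                ≡⟨ rotation-prefixBalance w i k ⟩
  (P (i + k) ℤ.- P i) ℤ.+ P (j ⊓ i)            ≡⟨ cong (λ x → (x ℤ.- P i) ℤ.+ P (j ⊓ i)) wraps ⟩
  (+ 0 ℤ.- P i) ℤ.+ P (j ⊓ i)                  ≡⟨ solve 2 (λ a b → (con (+ 0) :- a) :+ b := b :- a) refl (P i) (P (j ⊓ i)) ⟩
  P (j ⊓ i) ℤ.- P i                            ∎)
  where
  open ≡-Reasoning
  open +-*-Solver
  P = prefixBalance w
  j = k ∸ length (drop i w)
  |w|≤i+k : length w ≤ i + k
  |w|≤i+k = ℕP.≤-trans (ℕP.m≤n+m∸n (length w) i)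
    (ℕP.+-monoʳ-≤ i (subst (_≤ k) (LP.length-drop i w) (ℕP.<⇒≤ (ℕP.≰⇒> k>|d|))))
  wraps : P (i + k) ≡ + 0
  wraps = trans (cong balance (LP.take-all (i + k) w |w|≤i+k)) w≡0

balanced-disc-≤ : ∀ n w → balance w ≡ + 0 → (∀ t → ∣ prefixBalance w t ∣ ≤ n) → disc w ≤ n + n
balanced-disc-≤ n w w≡0 bound = disc-≤ (n + n) w circular
  where
  circular : ∀ i k → ∣ balance (take k (rotate i w)) ∣ ≤ n + n
  circular i k with circular-balance-as-difference w w≡0 i k
  ... | a , b , eq rewrite eq =
    ℕP.≤-trans (ℤP.∣i-j∣≤∣i∣+∣j∣ (prefixBalance w a) (prefixBalance w b)) (ℕP.+-mono-≤ (bound a) (bound b))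

-- The theorem: combine (1) and (2).
lemma3 : (n : ℕ) → 1 ≤ n → (αs : List BinStr) →
    All (λ α → count false α ≡ count true α) αs →
    All (λ α → disc α ≤ n) αs →
    disc (concat αs) ≤ 2 * n
lemma3 n _ αs balanced bounded = subst (disc (concat αs) ≤_) n+n≡2n
  (balanced-disc-≤ n (concat αs) (balance-concat αs balanced) (concat-prefixBalance-≤ αs balanced bounded))
  where
  n+n≡2n : n + n ≡ 2 * n
  n+n≡2n = cong (λ m → n + m) (sym (ℕP.+-identityʳ n))
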